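{- Let $T$ be an $s$-decreasing tree, let $1\le a<b\le n$ be such that $(a,b)$ is a tree ascent of $T$, and let $Z$ be the $s$-tree rotation of $T$ along $(a,b)$. Then for $1\le e<f\le n$, $(f,e)\in A_T(a,b)$ if and only if $f=b$ and $e\in T^a\setminus 0$, in which case $\#_Z(f,e)=\#_T(f,e)+1$.
   Context: $s=(s(1),\dots,s(n))$ is a sequence of nonnegative integers. An $s$-decreasing tree is a planar rooted tree $T$ whose internal vertices are labeled bijectively by $1,\dots,n$ (leaves unlabeled), such that internal vertex $i$ has exactly $s(i)+1$ children indexed $0,\dots,s(i)$ from left to right, and every labeled descendant of $i$ has smaller label. $T^i$ is the full subtree rooted at $i$, $T^i_j$ the full subtree rooted at the $j$-th child of $i$, and $T^i\setminus 0$ is $T^i$ with $T^i_0$ replaced by a leaf ($e\in T^i\setminus 0$ means $e$ is a labeled vertex of it). For $x<y$, $\#_T(y,x)$ is: $0$ if $x$ is left of $y$ or $x\in T^y_0$; $i$ if $x\in T^y_i$ with $0<i<s(y)$; $s(y)$ if $x\in T^y_{s(y)}$ or $x$ is right of $y$. $\mathrm{inv}(T)$ is the multiset of pairs $(y,x)$ with multiplicity $\#_T(y,x)$. For such multisets, $I+(b,a)$ increases the multiplicity of $(b,a)$ by one, capped at $s(b)$; $I$ is transitive if for all $a<b<c$ with $\#_I(c,b)=i$, either $\#_I(b,a)=0$ or $\#_I(c,a)\ge i$; $I^{tc}$ is the smallest (multiplicity-wise) transitive multiset containing $I$. For $a<b$, $(a,b)$ is a tree ascent of $T$ if (i) $a\in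 T^b_i$ for some $0\le i<s(b)$; (ii) whenever $a<e<b$ and $a\in T^e_j$, then $j=s(e)$; (iii) if $s(a)>0$ then $T^a_{s(a)}$ is a leaf. The $s$-tree rotation of $T$ along a tree ascent $(a,b)$ is the unique $s$-decreasing tree $Z$ with $\mathrm{inv}(Z)=(\mathrm{inv}(T)+(b,a))^{tc}$. $A_T(a,b)=\{(f,e):\#_Z(f,e)>\#_T(f,e)\}$. -}

module Defs where

open import Data.Nat using (ℕ; zero; suc; _≤_; _⊓_) renaming (_<_ to _<ℕ_)
open import Data.Fin using (Fin; toℕ; fromℕ; _<_)
open import Data.Fin.Properties using (_≟_)
open import Data.Bool using (Bool; true; false; if_then_else_; _∧_)
open import Data.List using (List; []; _∷_; _++_; allFin)
open import Data.List.Membership.Propositional using (_∈_)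
import Data.List.Membership.DecPropositional as DecMem
open import Data.List.Relation.Unary.All using (All)
open import Data.List.Relation.Binary.Permutation.Propositional using (_↭_)
open import Data.Vec using (Vec; []; _∷_; lookup)
import Data.Vec.Relation.Unary.All as VAll
open import Data.Maybe using (Maybe; just; nothing)
open import Data.Product using (Σ; ∃; _×_; _,_)
open import Data.Sum using (_⊎_)
open import Relation.Nullary using (yes; no; does)
open import Relation.Binary.PropositionalEquality using (_≡_)

-- Labels 1..n of the paper are represented by Fin n (label k ↦ k-1),
-- with the order of Fin (by toℕ).

module _ {n : ℕ} (s : Fin n → ℕ) where

  open DecMem (_≟_ {n}) using (_∈?_)

  -- Planar rooted trees whose internal vertex labelled i has exactly
  -- s(i)+1 children (indexed 0..s(i) left to right); leaves unlabelled.
  data STree : Set where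
    leaf : STree
    node : (i : Fin n) → Vec STree (suc (s i)) → STree

  labels  : STree → List (Fin n)
  labelsV : ∀ {k} → Vec STree k → List (Fin n)
  labels leaf = []
  labels (node i cs) = i ∷ labelsV cs
  labelsV [] = []
  labelsV (t ∷ ts) = labels t ++ labelsV ts

  subtreeAt  : Fin n → STree → Maybe STree
  subtreeAtV : ∀ {k} → Fin n → Vec STree k → Maybe STree
  subtreeAt y leaf = nothing
  subtreeAt y (node i cs) with y ≟ i
  ... | yes _ = just (node i cs)
  ... | no _ = subtreeAtV y cs
  subtreeAtV y [] = nothing
  subtreeAtV y (t ∷ ts) with subtreeAt y t
  ... | just u = just u
  ... | nothing = subtreeAtV y ts

  data Decreasing : STree → Set where
    leaf : Decreasing leaf
    node : ∀ {i cs} → All (λ x → x < i) (labelsV cs) →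
           VAll.All Decreasing cs → Decreasing (node i cs)

  IsSDecreasing : STree → Set
  IsSDecreasing T = (labels T ↭ allFin n) × Decreasing T

  -- x ∈ T^y_i : x is a labelled vertex of the subtree rooted at the
  -- i-th child of y
  InChild : STree → (y : Fin n) → Fin (suc (s y)) → Fin n → Set
  InChild T y i x = Σ (Vec STree (suc (s y))) λ cs →
    (subtreeAt y T ≡ just (node y cs)) × (x ∈ labels (lookup cs i))

  -- e ∈ T^a \ 0
  InMinus0 : STree → Fin n → Fin n → Set
  InMinus0 T a e = (e ≡ a) ⊎ Σ (Fin (suc (s a))) λ j → (0 <ℕ toℕ j) × InChild T a j e

  childIndex : ∀ {k} → Fin n → Vec STree k → ℕ → Maybe ℕ
  childIndex x [] m = nothing
  childIndex x (t ∷ ts) m with does (x ∈? labels t)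
  ... | true = just m
  ... | false = childIndex x ts (suc m)

  before : Fin n → Fin n → List (Fin n) → Bool
  before x y [] = false
  before x y (z ∷ l) with does (x ≟ z) | does (y ≟ z)
  ... | true | _ = true
  ... | false | true = false
  ... | false | false = before x y l

  -- #_T(y,x) for x < y: i if x ∈ T^y_i (this covers the cases 0, i, s(y)
  -- for x in a child subtree); otherwise 0 if x is left of y, s(y) if
  -- x is right of y.
  count : STree → Fin n → Fin n → ℕ
  count T y x with subtreeAt y T
  ... | nothing = 0
  ... | just leaf = 0
  ... | just (node i cs) with childIndex x cs 0
  ...   | just k = k
  ...   | nothing = if before x y (labels T) then 0 else s y

  -- multisets of pairs (y,x), x < y, as multiplicity functions
  Mult : Set
  Mult = Fin n → Fin n → ℕ

  inv : STree → Mult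
  inv T y x = count T y x

  addPair : Mult → Fin n → Fin n → Mult
  addPair I b a y x =
    if does (y ≟ b) ∧ does (x ≟ a) then suc (I y x) ⊓ s y else I y x

  Transitive : Mult → Set
  Transitive I = ∀ a b c → a < b → b < c → (I b a ≡ 0) ⊎ (I c b ≤ I c a)

  _⊆ᴹ_ : Mult → Mult → Set
  I ⊆ᴹ J = ∀ x y → x < y → I y x ≤ J y x

  IsTC : Mult → Mult → Set
  IsTC I J = Transitive J × (I ⊆ᴹ J) × (∀ K → Transitive K → I ⊆ᴹ K → J ⊆ᴹ K)

  TreeAscent : STree → Fin n → Fin n → Set
  TreeAscent T a b =
    (Σ (Fin (suc (s b))) λ i → (toℕ i <ℕ s b) × InChild T b i a)
    × (∀ e → a < e → e < b → ∀ j → InChild T e j a → toℕ j ≡ s e)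
    × (0 <ℕ s a → Σ (Vec STree (suc (s a))) λ cs →
         (subtreeAt a T ≡ just (node a cs)) × (lookup cs (fromℕ (s a)) ≡ leaf))

-- Give every vertex its address, the list of child indices on the path from
-- the root; #_T(y,x) is read off by comparing the addresses of y and x, which
-- makes inv(T) transitive.  Let I⁺ be inv(T) with (b,e) raised by one for
-- every e ∈ T^a∖0.  Every transitive K containing inv(T) + (b,a) contains I⁺:
-- for e in a child j > 0 of a, #(a,e) = j > 0 forces #_K(b,e) ≥ #_K(b,a).
-- Conversely I⁺ is transitive.  The only delicate case is a vertex x outside
-- T^a∖0 with #(y,x) > 0 for some y inside it: then x lies to the right of a,
-- and by condition (ii) of the ascent not inside the child T^b_i containing
-- a, so #(b,x) > i = #(b,y).  Hence inv(Z) = I⁺.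

module Submission where

open import Defs
open import Data.Bool using (Bool; true; false; not; _∧_; if_then_else_)
open import Data.Empty using (⊥; ⊥-elim)
open import Data.Fin using (Fin; toℕ; _<_) renaming (zero to fzero; suc to fsuc)
open import Data.Fin.Properties using (_≟_)
open import Data.List using (List; []; _∷_; _++_)
open import Data.List.Properties using (++-assoc; ++-identityʳ; ∷-injective; ∷-injectiveˡ; ++-cancelˡ)
open import Data.List.Membership.Propositional using (_∈_; _∉_)
open import Data.List.Membership.Propositional.Properties using (∈-++⁻; ∈-++⁺ˡ; ∈-++⁺ʳ; ∈-allFin)
open import Data.List.Relation.Unary.Any using (here; there)
import Data.List.Relation.Unary.All as All
import Data.List.Relation.Unary.All.Properties as All
open import Data.List.Relation.Unary.AllPairs as AllPairs using ([]; _∷_)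
open import Data.List.Relation.Unary.Unique.Propositional using (Unique)
open import Data.List.Relation.Unary.Unique.Propositional.Properties using (allFin⁺)
open import Data.List.Relation.Binary.Permutation.Propositional using (↭-sym; ↭⇒↭ₛ)
open import Data.List.Relation.Binary.Permutation.Propositional.Properties using (∈-resp-↭)
import Data.List.Relation.Binary.Permutation.Setoid.Properties as Permutationₛ
open import Data.Maybe using (just; nothing)
open import Data.Nat using (ℕ; zero; suc; _≤_; _≰_; z≤n; s≤s; _+_; _⊓_) renaming (_<_ to _<ℕ_)
open import Data.Nat.Properties hiding (_≟_)
open import Data.Nat.Properties using () renaming (_≟_ to _≟ℕ_)
open import Data.Product using (Σ; _×_; _,_; proj₁; proj₂)
open import Data.Product.Function.NonDependent.Propositional using (_×-⇔_)
open import Data.Sum using (_⊎_; inj₁; inj₂)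
open import Data.Vec using (Vec; []; _∷_; lookup)
import Data.Vec.Relation.Unary.All as VAll
open import Function.Bundles using (_⇔_; mk⇔; Equivalence)
open import Function.Construct.Composition using (_⇔-∘_)
open import Function.Construct.Identity using (⇔-id)
open import Function.Construct.Symmetry using (⇔-sym)
open import Relation.Binary using (tri<; tri≈; tri>)
open import Relation.Binary.PropositionalEquality
open import Relation.Nullary using (¬_; yes; no; does)

-- Addresses

Address : Set
Address = List ℕ

-- An address lists the child indices on the path from the root.  For y at
-- address p with s(y) = sy and x at address q, addrCount sy p q is #(y,x).
-- When q is a proper prefix of p (x an ancestor of y, which a decreasing tree
-- excludes for x < y) it is 0.
addrCount : ℕ → Address → Address → ℕ
addrCount sy []      []      = 0
addrCount sy []      (k ∷ q) = k
addrCount sy (v ∷ p) []      = 0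
addrCount sy (v ∷ p) (u ∷ q) with <-cmp u v
... | tri< _ _ _ = 0
... | tri≈ _ _ _ = addrCount sy p q
... | tri> _ _ _ = sy

addrCount-∷ : ∀ sy v p q → addrCount sy (v ∷ p) (v ∷ q) ≡ addrCount sy p q
addrCount-∷ sy v p q with <-cmp v v
... | tri< v<v _ _ = ⊥-elim (<-irrefl refl v<v)
... | tri≈ _ _ _   = refl
... | tri> _ _ v>v = ⊥-elim (<-irrefl refl v>v)

addrCount-++ : ∀ sy c p q → addrCount sy (c ++ p) (c ++ q) ≡ addrCount sy p q
addrCount-++ sy []      p q = refl
addrCount-++ sy (v ∷ c) p q = trans (addrCount-∷ sy v (c ++ p) (c ++ q)) (addrCount-++ sy c p q)

addrCount-self : ∀ sy p → addrCount sy p p ≡ 0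
addrCount-self sy []      = refl
addrCount-self sy (v ∷ p) = trans (addrCount-∷ sy v p p) (addrCount-self sy p)

addrCount-extension : ∀ sy p k r → addrCount sy p (p ++ k ∷ r) ≡ k
addrCount-extension sy []      k r = refl
addrCount-extension sy (v ∷ p) k r = trans (addrCount-∷ sy v p _) (addrCount-extension sy p k r)

addrCount-prefix : ∀ sy q k r → addrCount sy (q ++ k ∷ r) q ≡ 0
addrCount-prefix sy []      k r = refl
addrCount-prefix sy (v ∷ q) k r = trans (addrCount-∷ sy v _ q) (addrCount-prefix sy q k r)

addrCount-extend : ∀ sy p q w → (∀ w′ → p ≢ q ++ w′) → addrCount sy p (q ++ w) ≡ addrCount sy p q
addrCount-extend sy p       []      w p≢q++ = ⊥-elim (p≢q++ p refl)
addrCount-extend sy []      (v ∷ q) w p≢q++ = refl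
addrCount-extend sy (u ∷ p) (v ∷ q) w p≢q++ with <-cmp v u
... | tri< _ _ _    = refl
... | tri≈ _ refl _ = addrCount-extend sy p q w (λ w′ e → p≢q++ w′ (cong (v ∷_) e))
... | tri> _ _ _    = refl

data _◁_ (q p : Address) : Set where
  fork : ∀ c {u v} r₁ r₂ → u <ℕ v → q ≡ c ++ u ∷ r₁ → p ≡ c ++ v ∷ r₂ → q ◁ p

◁-extendʳ : ∀ {q p} w → q ◁ p → q ◁ (p ++ w)
◁-extendʳ {p = p} w (fork c {v = v} r₁ r₂ u<v refl refl) =
  fork c r₁ (r₂ ++ w) u<v refl (++-assoc c (v ∷ r₂) w)

◁-∷ : ∀ {q p} v → q ◁ p → (v ∷ q) ◁ (v ∷ p)
◁-∷ v (fork c r₁ r₂ u<v refl refl) = fork (v ∷ c) r₁ r₂ u<v refl refl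

◁-irrefl : ∀ {p} → ¬ p ◁ p
◁-irrefl (fork c r₁ r₂ u<v e₁ e₂) =
  <-irrefl (∷-injectiveˡ (++-cancelˡ c _ _ (trans (sym e₁) e₂))) u<v

addrCount-◁ : ∀ sy {q p} → q ◁ p → addrCount sy p q ≡ 0
addrCount-◁ sy (fork c {u} {v} r₁ r₂ u<v refl refl)
  rewrite addrCount-++ sy c (v ∷ r₂) (u ∷ r₁) with <-cmp u v
... | tri< _ _ _    = refl
... | tri≈ ¬u<v _ _ = ⊥-elim (¬u<v u<v)
... | tri> ¬u<v _ _ = ⊥-elim (¬u<v u<v)

addrCount-▷ : ∀ sy {q p} → p ◁ q → addrCount sy p q ≡ sy
addrCount-▷ sy (fork c {u} {v} r₁ r₂ u<v refl refl)
  rewrite addrCount-++ sy c (u ∷ r₁) (v ∷ r₂) with <-cmp v u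
... | tri< _ _ v≮u  = ⊥-elim (v≮u u<v)
... | tri≈ _ _ v≮u  = ⊥-elim (v≮u u<v)
... | tri> _ _ _    = refl

data Compare (p q : Address) : Set where
  equal     : p ≡ q → Compare p q
  extension : ∀ k r → q ≡ p ++ k ∷ r → Compare p q
  prefix    : ∀ k r → p ≡ q ++ k ∷ r → Compare p q
  left      : q ◁ p → Compare p q
  right     : p ◁ q → Compare p q

compare : ∀ p q → Compare p q
compare []      []      = equal refl
compare []      (k ∷ q) = extension k q refl
compare (k ∷ p) []      = prefix k p refl
compare (v ∷ p) (u ∷ q) with <-cmp u v
... | tri< u<v _ _  = left (fork [] q p u<v refl refl)
... | tri> _ _ v<u  = right (fork [] p q v<u refl refl)
... | tri≈ _ refl _ with compare p q
...   | equal e         = equal (cong (u ∷_) e)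
...   | extension k r e = extension k r (cong (u ∷_) e)
...   | prefix k r e    = prefix k r (cong (u ∷_) e)
...   | left q◁p        = left (◁-∷ u q◁p)
...   | right p◁q       = right (◁-∷ u p◁q)

ArityBounded : ℕ → Address → Address → Set
ArityBounded sy p q = ∀ k r → q ≡ p ++ k ∷ r → k ≤ sy

addrCount-≤ : ∀ sy p q → ArityBounded sy p q → addrCount sy p q ≤ sy
addrCount-≤ sy p q bounded with compare p q
... | equal refl      rewrite addrCount-self sy p        = z≤n
... | extension k r refl rewrite addrCount-extension sy p k r = bounded k r refl
... | prefix k r refl rewrite addrCount-prefix sy q k r  = z≤n
... | left q◁p        rewrite addrCount-◁ sy q◁p         = z≤n
... | right p◁q       rewrite addrCount-▷ sy p◁q         = ≤-refl

addrCount-transitive : ∀ sy sz pz py px → ArityBounded sz pz py →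
  0 <ℕ addrCount sy py px → addrCount sz pz py ≤ addrCount sz pz px
addrCount-transitive sy sz []       []       px       bounded pos = z≤n
addrCount-transitive sy sz (w ∷ pz) []       px       bounded pos = z≤n
addrCount-transitive sy sz pz       (v ∷ py) []       bounded ()
addrCount-transitive sy sz []       (v ∷ py) (u ∷ px) bounded pos with <-cmp u v
... | tri< _ _ _    = ⊥-elim (<-irrefl refl pos)
... | tri≈ _ refl _ = ≤-refl
... | tri> _ _ v<u  = <⇒≤ v<u
addrCount-transitive sy sz (w ∷ pz) (v ∷ py) (u ∷ px) bounded pos with <-cmp u v
... | tri< _ _ _    = ⊥-elim (<-irrefl refl pos)
... | tri≈ _ refl _ with <-cmp u w
...   | tri< _ _ _    = z≤n
...   | tri≈ _ refl _ = addrCount-transitive sy sz pz py px (λ k r e → bounded k r (cong (u ∷_) e)) pos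
...   | tri> _ _ _    = ≤-refl
addrCount-transitive sy sz (w ∷ pz) (v ∷ py) (u ∷ px) bounded pos | tri> _ _ v<u with <-cmp v w
... | tri< _ _ _    = z≤n
... | tri≈ _ refl _ rewrite addrCount-▷ sz (fork [] pz px v<u refl refl) =
  addrCount-≤ sz pz py (λ k r e → bounded k r (cong (v ∷_) e))
... | tri> _ _ w<v  rewrite addrCount-▷ sz (fork [] pz px (<-trans w<v v<u) refl refl) = ≤-refl

data InMinus0View (p q : Address) : Set where
  self  : q ≡ p → InMinus0View p q
  child : ∀ j r → 0 <ℕ j → q ≡ p ++ j ∷ r → InMinus0View p q

inMinus0ᵇ : Address → Address → Bool
inMinus0ᵇ []      []          = true
inMinus0ᵇ []      (zero ∷ _)  = false
inMinus0ᵇ []      (suc _ ∷ _) = true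
inMinus0ᵇ (_ ∷ _) []          = false
inMinus0ᵇ (v ∷ p) (u ∷ q) with u ≟ℕ v
... | yes _ = inMinus0ᵇ p q
... | no _  = false

inMinus0ᵇ-self : ∀ p → inMinus0ᵇ p p ≡ true
inMinus0ᵇ-self []      = refl
inMinus0ᵇ-self (v ∷ p) with v ≟ℕ v
... | yes _  = inMinus0ᵇ-self p
... | no v≢v = ⊥-elim (v≢v refl)

inMinus0ᵇ-child : ∀ p {j} r → 0 <ℕ j → inMinus0ᵇ p (p ++ j ∷ r) ≡ true
inMinus0ᵇ-child []      {suc j} r _   = refl
inMinus0ᵇ-child (v ∷ p)         r 0<j with v ≟ℕ v
... | yes _  = inMinus0ᵇ-child p r 0<j
... | no v≢v = ⊥-elim (v≢v refl)

inMinus0ᵇ-sound : ∀ p q → inMinus0ᵇ p q ≡ true → InMinus0View p q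
inMinus0ᵇ-sound []      []          _ = self refl
inMinus0ᵇ-sound []      (suc j ∷ r) _ = child (suc j) r (s≤s z≤n) refl
inMinus0ᵇ-sound (v ∷ p) (u ∷ q) h with u ≟ℕ v
inMinus0ᵇ-sound (v ∷ p) (u ∷ q) h | yes refl with inMinus0ᵇ-sound p q h
... | self e          = self (cong (u ∷_) e)
... | child j r 0<j e = child j r 0<j (cong (u ∷_) e)
inMinus0ᵇ-sound (v ∷ p) (u ∷ q) () | no _

data SplitPoints (p : Address) (k : ℕ) (c : Address) (v : ℕ) : Set where
  same    : p ≡ c → k ≡ v → SplitPoints p k c v
  later   : ∀ c′ → c ≡ p ++ k ∷ c′ → SplitPoints p k c v
  earlier : ∀ p′ → p ≡ c ++ v ∷ p′ → SplitPoints p k c v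

splitPoints : ∀ p k r c v r′ → p ++ k ∷ r ≡ c ++ v ∷ r′ → SplitPoints p k c v
splitPoints []      k r []      v r′ refl = same refl refl
splitPoints []      k r (w ∷ c) v r′ refl = later c refl
splitPoints (w ∷ p) k r []      v r′ refl = earlier p refl
splitPoints (w ∷ p) k r (w′ ∷ c) v r′ e with ∷-injective e
... | refl , e′ with splitPoints p k r c v r′ e′
...   | same refl refl = same refl refl
...   | later c′ refl  = later c′ refl
...   | earlier p′ refl = earlier p′ refl

data _≺_ (q p : Address) : Set where
  ancestor : ∀ k r → p ≡ q ++ k ∷ r → q ≺ p
  leftOf   : q ◁ p → q ≺ p

≺-[] : ∀ {q} → ¬ q ≺ []
≺-[] {[]}    (ancestor k r ())
≺-[] {_ ∷ _} (ancestor k r ())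
≺-[] (leftOf (fork []      r₁ r₂ u<v e₁ ()))
≺-[] (leftOf (fork (_ ∷ c) r₁ r₂ u<v e₁ ()))

≺-∷⁻ : ∀ {u v q p} → (u ∷ q) ≺ (v ∷ p) → (u ≡ v × q ≺ p) ⊎ u <ℕ v
≺-∷⁻ (ancestor k r refl)                         = inj₁ (refl , ancestor k r refl)
≺-∷⁻ (leftOf (fork []      r₁ r₂ u<v refl refl)) = inj₂ u<v
≺-∷⁻ (leftOf (fork (w ∷ c) r₁ r₂ u<v refl refl)) = inj₁ (refl , leftOf (fork c r₁ r₂ u<v refl refl))

-- The rotation, for an abstract addressing

sucIf : Bool → ℕ → ℕ
sucIf true  m = suc m
sucIf false m = m

m≤sucIf : ∀ c m → m ≤ sucIf c m
m≤sucIf true  m = n≤1+n m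
m≤sucIf false m = ≤-refl

sucIf-mono : ∀ c d {m k} → m ≤ k → (c ≡ true → d ≡ false → m <ℕ k) → sucIf c m ≤ sucIf d k
sucIf-mono false d     m≤k _      = ≤-trans m≤k (m≤sucIf d _)
sucIf-mono true  true  m≤k _      = s≤s m≤k
sucIf-mono true  false _   strict = strict refl refl

-- An assignment of addresses to the labels 1..n, with the properties that
-- the addresses of the vertices of an s-decreasing tree have.
record Addressing {n : ℕ} (s : Fin n → ℕ) : Set where
  field
    addr            : Fin n → Address
    addr-injective  : ∀ x y → addr x ≡ addr y → x ≡ y
    addr-decreasing : ∀ x e k r → addr x ≡ addr e ++ k ∷ r → x < e
    addr-prefix     : ∀ x c k r → addr x ≡ c ++ k ∷ r → Σ (Fin n) λ e → addr e ≡ c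
    addr-arity      : ∀ x e k r → addr x ≡ addr e ++ k ∷ r → k ≤ s e

record Ascent {n : ℕ} {s : Fin n → ℕ} (A : Addressing s) (a b : Fin n) : Set where
  open Addressing A
  field
    index       : ℕ
    rest        : Address
    addr-a      : addr a ≡ addr b ++ index ∷ rest
    index<arity : index <ℕ s b
    rightmost   : ∀ e → a < e → e < b → ∀ j r → addr a ≡ addr e ++ j ∷ r → j ≡ s e

module Rotation {n : ℕ} {s : Fin n → ℕ} (A : Addressing s) (I : Mult s)
  (I≡addrCount : ∀ y x → I y x ≡ addrCount (s y) (Addressing.addr A y) (Addressing.addr A x)) where

  open Addressing A

  I-extension : ∀ {x y k r} → addr x ≡ addr y ++ k ∷ r → I y x ≡ k
  I-extension {x} {y} {k} {r} e =
    trans (I≡addrCount y x) (trans (cong (addrCount (s y) (addr y)) e) (addrCount-extension (s y) (addr y) k r))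

  I-◁ : ∀ {x y} → addr x ◁ addr y → I y x ≡ 0
  I-◁ {x} {y} x◁y = trans (I≡addrCount y x) (addrCount-◁ (s y) x◁y)

  I-▷ : ∀ {x y} → addr y ◁ addr x → I y x ≡ s y
  I-▷ {x} {y} y◁x = trans (I≡addrCount y x) (addrCount-▷ (s y) y◁x)

  I-≤ : ∀ y x → I y x ≤ s y
  I-≤ y x rewrite I≡addrCount y x = addrCount-≤ (s y) (addr y) (addr x) (addr-arity x y)

  I-transitive : Transitive s I
  I-transitive x y z x<y y<z with I y x in eq
  ... | zero  = inj₁ refl
  ... | suc _ rewrite I≡addrCount z y | I≡addrCount z x =
    inj₂ (addrCount-transitive (s y) (s z) (addr z) (addr y) (addr x) (addr-arity y z)
           (subst (0 <ℕ_) (trans (sym eq) (I≡addrCount y x)) (s≤s z≤n)))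

  I-descendant : ∀ {x y z} w → y < z → addr x ≡ addr y ++ w → I z x ≡ I z y
  I-descendant {x} {y} {z} w y<z e = begin
    I z x                                   ≡⟨ I≡addrCount z x ⟩
    addrCount (s z) (addr z) (addr x)       ≡⟨ cong (addrCount (s z) (addr z)) e ⟩
    addrCount (s z) (addr z) (addr y ++ w)  ≡⟨ addrCount-extend (s z) (addr z) (addr y) w z-not-below-y ⟩
    addrCount (s z) (addr z) (addr y)       ≡⟨ sym (I≡addrCount z y) ⟩
    I z y                                   ∎
    where
    open ≡-Reasoning
    z-not-below-y : ∀ w′ → addr z ≢ addr y ++ w′
    z-not-below-y []      e′ =
      <-irrefl (cong toℕ (addr-injective y z (trans (sym (++-identityʳ (addr y))) (sym e′)))) y<z
    z-not-below-y (k ∷ r) e′ = <-asym y<z (addr-decreasing z y k r e′)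

  module _ {a b : Fin n} (asc : Ascent A a b) where
    open Ascent asc

    a<b : a < b
    a<b = addr-decreasing a b index rest addr-a

    inRegion : Fin n → Bool
    inRegion x = inMinus0ᵇ (addr a) (addr x)

    region-below-a : ∀ {y} → inRegion y ≡ true → Σ Address λ w → addr y ≡ addr a ++ w
    region-below-a {y} hy with inMinus0ᵇ-sound (addr a) (addr y) hy
    ... | self e          = [] , trans e (sym (++-identityʳ (addr a)))
    ... | child j r _ e   = j ∷ r , e

    region-below-b : ∀ {y} → inRegion y ≡ true → Σ Address λ w → addr y ≡ addr b ++ index ∷ w
    region-below-b {y} hy with region-below-a hy
    ... | w , e = rest ++ w , trans e (trans (cong (_++ w) addr-a) (++-assoc (addr b) (index ∷ rest) w))

    region-≤a : ∀ {y} → inRegion y ≡ true → toℕ y ≤ toℕ a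
    region-≤a {y} hy with inMinus0ᵇ-sound (addr a) (addr y) hy
    ... | self e        = ≤-reflexive (cong toℕ (addr-injective y a e))
    ... | child j r _ e = <⇒≤ (addr-decreasing y a j r e)

    I-b-region : ∀ {x} → inRegion x ≡ true → I b x ≡ index
    I-b-region hx = I-extension (proj₂ (region-below-b hx))

    I-region-◁ : ∀ {x y} → inRegion y ≡ true → addr x ◁ addr a → I y x ≡ 0
    I-region-◁ {x} {y} hy x◁a with region-below-a hy
    ... | w , e = I-◁ (subst (addr x ◁_) (sym e) (◁-extendʳ w x◁a))

    I-region-zeroChild : ∀ {x y r} → inRegion y ≡ true → addr x ≡ addr a ++ 0 ∷ r → I y x ≡ 0
    I-region-zeroChild {x} {y} {r} hy ex with inMinus0ᵇ-sound (addr a) (addr y) hy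
    ... | self ey           = I-extension (trans ex (cong (_++ 0 ∷ r) (sym ey)))
    ... | child j r′ 0<j ey = I-◁ (fork (addr a) r r′ 0<j ex ey)

    -- A vertex right of a but inside T^b_index would be a fork vertex e with
    -- a < e < b in whose last subtree a does not lie.
    I-b-right-of-a : ∀ {x} → addr a ◁ addr x → index <ℕ I b x
    I-b-right-of-a {x} (fork c {v} {u} r₁ r₂ v<u ea ex)
      with splitPoints (addr b) index rest c v r₁ (trans (sym addr-a) ea)
    ... | same refl refl  = subst (index <ℕ_) (sym (I-extension ex)) v<u
    ... | earlier p′ eb   = subst (index <ℕ_) (sym (I-▷ (fork c p′ r₂ v<u eb ex))) index<arity
    ... | later c′ ec with addr-prefix x c u r₂ ex
    ...   | e , ee = ⊥-elim (<-irrefl refl (<-≤-trans v<u (subst (u ≤_) (sym v≡se) u≤se)))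
      where
      a-below-e : addr a ≡ addr e ++ v ∷ r₁
      a-below-e = trans ea (cong (_++ v ∷ r₁) (sym ee))
      v≡se : v ≡ s e
      v≡se = rightmost e (addr-decreasing a e v r₁ a-below-e)
                         (addr-decreasing e b index c′ (trans ee ec)) v r₁ a-below-e
      u≤se : u ≤ s e
      u≤se = addr-arity x e u r₂ (trans ex (cong (_++ u ∷ r₂) (sym ee)))

    I-b-leaving-region : ∀ {x y} → x < y → inRegion y ≡ true → inRegion x ≡ false →
      0 <ℕ I y x → index <ℕ I b x
    I-b-leaving-region {x} {y} x<y hy hx pos = by-position (compare (addr a) (addr x))
      where
      region-at : ∀ {q} → q ≡ addr x → inMinus0ᵇ (addr a) q ≢ true
      region-at refl h with trans (sym h) hx
      ... | ()
      by-position : Compare (addr a) (addr x) → index <ℕ I b x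
      by-position (equal e)             = ⊥-elim (region-at e (inMinus0ᵇ-self (addr a)))
      by-position (extension (suc k) r e) = ⊥-elim (region-at (sym e) (inMinus0ᵇ-child (addr a) r (s≤s z≤n)))
      by-position (extension zero r e)  = ⊥-elim (<-irrefl (sym (I-region-zeroChild hy e)) pos)
      by-position (prefix k r e)        =
        ⊥-elim (<-irrefl refl (<-≤-trans x<y (≤-trans (region-≤a hy) (<⇒≤ (addr-decreasing a x k r e)))))
      by-position (left x◁a)            = ⊥-elim (<-irrefl (sym (I-region-◁ hy x◁a)) pos)
      by-position (right a◁x)           = I-b-right-of-a a◁x

    -- The candidate for (inv T + (b,a))^tc.
    I⁺ : Mult s
    I⁺ y x = sucIf (does (y ≟ b) ∧ inRegion x) (I y x)

    I⁺-transitive : Transitive s I⁺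
    I⁺-transitive x y z x<y y<z with z ≟ b | y ≟ b
    ... | no _     | no _     = I-transitive x y z x<y y<z
    ... | yes refl | yes refl = ⊥-elim (<-irrefl refl y<z)
    ... | no _     | yes refl with inRegion x in hx
    ...   | false = I-transitive x b z x<y y<z
    ...   | true with region-below-b hx
    ...     | w , ex = inj₂ (≤-reflexive (sym (I-descendant (index ∷ w) y<z ex)))
    I⁺-transitive x y z x<y y<z | yes refl | no _ with I y x in eq
    ... | zero  = inj₁ refl
    ... | suc _ = inj₂ (sucIf-mono (inRegion y) (inRegion x) I-b-mono strict)
      where
      pos : 0 <ℕ I y x
      pos = subst (0 <ℕ_) (sym eq) (s≤s z≤n)
      I-b-mono : I b y ≤ I b x
      I-b-mono with I-transitive x y b x<y y<z
      ... | inj₁ I≡0 = ⊥-elim (<-irrefl (sym I≡0) pos)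
      ... | inj₂ le  = le
      strict : inRegion y ≡ true → inRegion x ≡ false → I b y <ℕ I b x
      strict hy hx = subst (_<ℕ I b x) (sym (I-b-region hy)) (I-b-leaving-region x<y hy hx pos)

    I⁺-region : ∀ {x} → inRegion x ≡ true → I⁺ b x ≡ suc (I b x)
    I⁺-region hx with b ≟ b
    ... | yes _  rewrite hx = refl
    ... | no b≢b = ⊥-elim (b≢b refl)

    addPair≤I⁺ : ∀ y x → addPair s I b a y x ≤ I⁺ y x
    addPair≤I⁺ y x with y ≟ b | x ≟ a
    ... | yes refl | yes refl rewrite inMinus0ᵇ-self (addr a) = m⊓n≤m _ _
    ... | yes refl | no _     = m≤sucIf _ _
    ... | no _     | _        = ≤-refl

    module _ (J : Mult s) (tc : IsTC s (addPair s I b a) J) where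

      J-transitive : Transitive s J
      J-transitive = proj₁ tc

      addPair⊆J : _⊆ᴹ_ s (addPair s I b a) J
      addPair⊆J = proj₁ (proj₂ tc)

      I≤J : ∀ x y → x < y → I y x ≤ J y x
      I≤J x y x<y = ≤-trans (I≤addPair y x) (addPair⊆J x y x<y)
        where
        I≤addPair : ∀ y x → I y x ≤ addPair s I b a y x
        I≤addPair y x with does (y ≟ b) ∧ does (x ≟ a)
        ... | true  = ⊓-glb (n≤1+n _) (I-≤ y x)
        ... | false = ≤-refl

      index<J-ba : index <ℕ J b a
      index<J-ba = subst (_≤ J b a) addPair-ba (addPair⊆J a b a<b)
        where
        addPair-ba : addPair s I b a b a ≡ suc index
        addPair-ba with b ≟ b | a ≟ a
        ... | yes _  | yes _  = trans (cong (λ m → suc m ⊓ s b) (I-b-region (inMinus0ᵇ-self (addr a))))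
                                      (m≤n⇒m⊓n≡m index<arity)
        ... | no b≢b | _      = ⊥-elim (b≢b refl)
        ... | yes _  | no a≢a = ⊥-elim (a≢a refl)

      -- For e in a child j > 0 of a, #(a,e) = j > 0, so transitivity of J
      -- propagates the new inversion (b,a) to (b,e).
      I<J-region : ∀ e → inRegion e ≡ true → I b e <ℕ J b e
      I<J-region e he rewrite I-b-region he with inMinus0ᵇ-sound (addr a) (addr e) he
      ... | self ee rewrite addr-injective e a ee = index<J-ba
      ... | child j r 0<j ee with J-transitive e a b (addr-decreasing e a j r ee) a<b
      ...   | inj₂ J-ba≤J-be = <-≤-trans index<J-ba J-ba≤J-be
      ...   | inj₁ J-ae≡0    = ⊥-elim (<-irrefl (sym J-ae≡0) (<-≤-trans 0<j j≤J-ae))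
        where
        j≤J-ae : j ≤ J a e
        j≤J-ae = subst (_≤ J a e) (I-extension ee) (I≤J e a (addr-decreasing e a j r ee))

      J≡I⁺ : ∀ e f → e < f → J f e ≡ I⁺ f e
      J≡I⁺ e f e<f =
        ≤-antisym (proj₂ (proj₂ tc) I⁺ I⁺-transitive (λ x y _ → addPair≤I⁺ y x) e f e<f) I⁺≤J
        where
        I⁺≤J : I⁺ f e ≤ J f e
        I⁺≤J with f ≟ b | inRegion e in he
        ... | no _     | _     = I≤J e f e<f
        ... | yes refl | false = I≤J e b e<f
        ... | yes refl | true  = I<J-region e he

      J-increment : ∀ e f → e < f → f ≡ b × inRegion e ≡ true → J f e ≡ suc (I f e)
      J-increment e f e<f (refl , he) = trans (J≡I⁺ e b e<f) (I⁺-region he)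

      I<J⇔ : ∀ e f → e < f → (I f e <ℕ J f e) ⇔ (f ≡ b × inRegion e ≡ true)
      I<J⇔ e f e<f = mk⇔ added (λ h → ≤-reflexive (sym (J-increment e f e<f h)))
        where
        added : I f e <ℕ J f e → f ≡ b × inRegion e ≡ true
        added I<J rewrite J≡I⁺ e f e<f with f ≟ b | inRegion e
        ... | yes refl | true  = refl , refl
        ... | yes refl | false = ⊥-elim (<-irrefl refl I<J)
        ... | no _     | _     = ⊥-elim (<-irrefl refl I<J)

-- Trees and their addressing

data Child {X : Set} : ∀ {m} → Vec X m → ℕ → X → Set where
  here  : ∀ {m t} {ts : Vec X m} → Child (t ∷ ts) 0 t
  there : ∀ {m t u k} {ts : Vec X m} → Child ts k u → Child (t ∷ ts) (suc k) u

module _ {X : Set} where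

  Child-functional : ∀ {m} {cs : Vec X m} {k t t′} → Child cs k t → Child cs k t′ → t ≡ t′
  Child-functional here      here      = refl
  Child-functional (there c) (there c′) = Child-functional c c′

  Child-bound : ∀ {m} {cs : Vec X m} {k t} → Child cs k t → k <ℕ m
  Child-bound here      = s≤s z≤n
  Child-bound (there c) = s≤s (Child-bound c)

  Child-lookup : ∀ {m} (cs : Vec X m) (j : Fin m) → Child cs (toℕ j) (lookup cs j)
  Child-lookup (c ∷ cs) fzero    = here
  Child-lookup (c ∷ cs) (fsuc j) = there (Child-lookup cs j)

  Child⇒lookup : ∀ {m} {cs : Vec X m} {k t} → Child cs k t → Σ (Fin m) λ j → toℕ j ≡ k × lookup cs j ≡ t
  Child⇒lookup here = fzero , refl , refl
  Child⇒lookup (there c) with Child⇒lookup c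
  ... | j , refl , e = fsuc j , refl , e

  Child-All : ∀ {P : X → Set} {m} {cs : Vec X m} {k t} → Child cs k t → VAll.All P cs → P t
  Child-All here      (p VAll.∷ _)  = p
  Child-All (there c) (_ VAll.∷ ps) = Child-All c ps

  Unique-++⁻ : ∀ (l₁ : List X) {l₂} → Unique (l₁ ++ l₂) →
    Unique l₁ × Unique l₂ × (∀ {x} → x ∈ l₁ → x ∉ l₂)
  Unique-++⁻ []       u        = [] , u , λ ()
  Unique-++⁻ (z ∷ l₁) (z∉ ∷ u) with Unique-++⁻ l₁ u
  ... | u₁ , u₂ , disjoint = proj₁ (All.++⁻ l₁ z∉) ∷ u₁ , u₂ , disjoint′
    where
    disjoint′ : ∀ {x} → x ∈ z ∷ l₁ → x ∉ _
    disjoint′ (here refl) m = All.lookup (proj₂ (All.++⁻ l₁ z∉)) m refl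
    disjoint′ (there m₁)  m = disjoint m₁ m

module Trees {n : ℕ} (s : Fin n → ℕ) where
  open import Data.List.Membership.DecPropositional (_≟_ {n}) using (_∈?_)

  Tree : Set
  Tree = STree s

  data Subtree : Tree → Address → Tree → Set where
    root  : ∀ {t} → Subtree t [] t
    child : ∀ {i cs k t p u} → Child cs k t → Subtree t p u → Subtree (node i cs) (k ∷ p) u

  VertexAt : Tree → Address → Fin n → Set
  VertexAt T p x = Σ (Vec Tree (suc (s x))) λ cs → Subtree T p (node x cs)

  Subtree-functional : ∀ {T p u u′} → Subtree T p u → Subtree T p u′ → u ≡ u′
  Subtree-functional root          root           = refl
  Subtree-functional (child c₁ s₁) (child c₂ s₂) with Child-functional c₁ c₂
  ... | refl = Subtree-functional s₁ s₂

  Subtree-++ : ∀ {T c w q v} → Subtree T c w → Subtree w q v → Subtree T (c ++ q) v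
  Subtree-++ root         s₂ = s₂
  Subtree-++ (child c s₁) s₂ = child c (Subtree-++ s₁ s₂)

  Subtree-++⁻ : ∀ {T} c {q v} → Subtree T (c ++ q) v → Σ Tree λ w → Subtree T c w × Subtree w q v
  Subtree-++⁻ []      s₁           = _ , root , s₁
  Subtree-++⁻ (k ∷ c) (child ck s₁) with Subtree-++⁻ c s₁
  ... | w , s₂ , s₃ = w , child ck s₂ , s₃

  Subtree-decreasing : ∀ {T p u} → Subtree T p u → Decreasing s T → Decreasing s u
  Subtree-decreasing root         d            = d
  Subtree-decreasing (child c s₁) (node _ ds) = Subtree-decreasing s₁ (Child-All c ds)

  node-injectiveˡ : ∀ {x y} {cs : Vec Tree (suc (s x))} {cs′ : Vec Tree (suc (s y))} →
    node x cs ≡ node y cs′ → x ≡ y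
  node-injectiveˡ refl = refl

  Child-labels : ∀ {m} {cs : Vec Tree m} {k t x} → Child cs k t → x ∈ labels s t → x ∈ labelsV s cs
  Child-labels {cs = t ∷ ts} here      m = ∈-++⁺ˡ m
  Child-labels {cs = t ∷ ts} (there c) m = ∈-++⁺ʳ (labels s t) (Child-labels c m)

  VertexAt⇒∈ : ∀ {T p x} → VertexAt T p x → x ∈ labels s T
  VertexAt⇒∈ (cs , root)         = here refl
  VertexAt⇒∈ (cs , child c s₁) = there (Child-labels c (VertexAt⇒∈ (cs , s₁)))

  mutual
    ∈⇒VertexAt : ∀ T {x} → x ∈ labels s T → Σ Address λ p → VertexAt T p x
    ∈⇒VertexAt (node i cs) (here refl) = [] , cs , root
    ∈⇒VertexAt (node i cs) (there m) with ∈⇒VertexAtᵛ cs m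
    ... | k , t , c , p , cs′ , s₁ = k ∷ p , cs′ , child c s₁

    ∈⇒VertexAtᵛ : ∀ {m} (cs : Vec Tree m) {x} → x ∈ labelsV s cs →
      Σ ℕ λ k → Σ Tree λ t → Child cs k t × Σ Address λ p → VertexAt t p x
    ∈⇒VertexAtᵛ (t ∷ ts) m with ∈-++⁻ (labels s t) m
    ... | inj₁ m₁ = 0 , t , here , ∈⇒VertexAt t m₁
    ... | inj₂ m₂ with ∈⇒VertexAtᵛ ts m₂
    ...   | k , u , c , rest = suc k , u , there c , rest

  Child-index-unique : ∀ {m} (cs : Vec Tree m) → Unique (labelsV s cs) → ∀ {k k′ t t′ x} →
    Child cs k t → Child cs k′ t′ → x ∈ labels s t → x ∈ labels s t′ → k ≡ k′
  Child-index-unique (t ∷ ts) u here       here       m₁ m₂ = refl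
  Child-index-unique (t ∷ ts) u here       (there c₂) m₁ m₂ =
    ⊥-elim (proj₂ (proj₂ (Unique-++⁻ (labels s t) u)) m₁ (Child-labels c₂ m₂))
  Child-index-unique (t ∷ ts) u (there c₁) here       m₁ m₂ =
    ⊥-elim (proj₂ (proj₂ (Unique-++⁻ (labels s t) u)) m₂ (Child-labels c₁ m₁))
  Child-index-unique (t ∷ ts) u (there c₁) (there c₂) m₁ m₂ =
    cong suc (Child-index-unique ts (proj₁ (proj₂ (Unique-++⁻ (labels s t) u))) c₁ c₂ m₁ m₂)

  Child-Unique : ∀ {m} (cs : Vec Tree m) → Unique (labelsV s cs) → ∀ {k t} → Child cs k t → Unique (labels s t)
  Child-Unique (t ∷ ts) u here      = proj₁ (Unique-++⁻ (labels s t) u)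
  Child-Unique (t ∷ ts) u (there c) = Child-Unique ts (proj₁ (proj₂ (Unique-++⁻ (labels s t) u))) c

  root∉children : ∀ {i cs k t} → Unique (labels s (node i cs)) → Child cs k t → i ∉ labels s t
  root∉children (i∉ ∷ _) c m = All.lookup i∉ (Child-labels c m) refl

  VertexAt-unique : ∀ T → Unique (labels s T) → ∀ {p q x} → VertexAt T p x → VertexAt T q x → p ≡ q
  VertexAt-unique T u (_ , root) (_ , root) = refl
  VertexAt-unique (node i cs) u (_ , root) (cs₂ , child c s₂) =
    ⊥-elim (root∉children u c (VertexAt⇒∈ (cs₂ , s₂)))
  VertexAt-unique (node i cs) u (cs₁ , child c s₁) (_ , root) =
    ⊥-elim (root∉children u c (VertexAt⇒∈ (cs₁ , s₁)))
  VertexAt-unique (node i cs) (_ ∷ u) (cs₁ , child {t = t} c₁ s₁) (cs₂ , child c₂ s₂)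
    with Child-index-unique cs u c₁ c₂ (VertexAt⇒∈ (cs₁ , s₁)) (VertexAt⇒∈ (cs₂ , s₂))
  ... | refl with Child-functional c₁ c₂
  ...   | refl = cong (_ ∷_) (VertexAt-unique t (Child-Unique cs u c₁) (cs₁ , s₁) (cs₂ , s₂))

  mutual
    subtreeAt-sound : ∀ T {y u} → subtreeAt s y T ≡ just u →
      Σ Address λ p → Subtree T p u × Σ (Vec Tree (suc (s y))) λ cs → u ≡ node y cs
    subtreeAt-sound leaf ()
    subtreeAt-sound (node i cs) {y} e with y ≟ i
    subtreeAt-sound (node i cs) refl | yes refl = [] , root , cs , refl
    ... | no _ with subtreeAt-soundᵛ cs e
    ...   | k , t , c , p , s₁ , rest = k ∷ p , child c s₁ , rest

    subtreeAt-soundᵛ : ∀ {m} (cs : Vec Tree m) {y u} → subtreeAtV s y cs ≡ just u →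
      Σ ℕ λ k → Σ Tree λ t → Child cs k t ×
        Σ Address λ p → Subtree t p u × Σ (Vec Tree (suc (s y))) λ cs → u ≡ node y cs
    subtreeAt-soundᵛ [] ()
    subtreeAt-soundᵛ (t ∷ ts) {y} e with subtreeAt s y t in e₁
    subtreeAt-soundᵛ (t ∷ ts) refl | just _ = 0 , t , here , subtreeAt-sound t e₁
    ... | nothing with subtreeAt-soundᵛ ts e
    ...   | k , u , c , rest = suc k , u , there c , rest

  mutual
    subtreeAt-complete : ∀ T {y} → y ∈ labels s T → subtreeAt s y T ≢ nothing
    subtreeAt-complete (node i cs) {y} m e with y ≟ i
    subtreeAt-complete (node i cs) m         () | yes _
    subtreeAt-complete (node i cs) (here y≡i) e | no y≢i = y≢i y≡i
    subtreeAt-complete (node i cs) (there m) e  | no _   = subtreeAt-completeᵛ cs m e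

    subtreeAt-completeᵛ : ∀ {k} (cs : Vec Tree k) {y} → y ∈ labelsV s cs → subtreeAtV s y cs ≢ nothing
    subtreeAt-completeᵛ (t ∷ ts) {y} m e with subtreeAt s y t in e₁
    subtreeAt-completeᵛ (t ∷ ts) m () | just _
    ... | nothing with ∈-++⁻ (labels s t) m
    ...   | inj₁ m₁ = subtreeAt-complete t m₁ e₁
    ...   | inj₂ m₂ = subtreeAt-completeᵛ ts m₂ e

  childIndex-just : ∀ {m} (cs : Vec Tree m) k₀ {x k} → childIndex s x cs k₀ ≡ just k →
    Σ ℕ λ j → Σ Tree λ t → k ≡ k₀ + j × Child cs j t × x ∈ labels s t
  childIndex-just []       k₀ ()
  childIndex-just (t ∷ ts) k₀ {x} e with x ∈? labels s t
  childIndex-just (t ∷ ts) k₀ refl | yes m = 0 , t , sym (+-identityʳ k₀) , here , m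
  ... | no _ with childIndex-just ts (suc k₀) e
  ...   | j , u , refl , c , m = suc j , u , sym (+-suc k₀ j) , there c , m

  childIndex-nothing : ∀ {m} (cs : Vec Tree m) k₀ {x} → childIndex s x cs k₀ ≡ nothing →
    ∀ {j t} → Child cs j t → x ∉ labels s t
  childIndex-nothing (t ∷ ts) k₀ {x} e c m with x ∈? labels s t
  childIndex-nothing (t ∷ ts) k₀ () c m         | yes _
  childIndex-nothing (t ∷ ts) k₀ e here m       | no x∉t = x∉t m
  childIndex-nothing (t ∷ ts) k₀ e (there c) m  | no _   = childIndex-nothing ts (suc k₀) e c m

  before-here : ∀ {x y} l → x ∈ l → y ∉ l → before s x y l ≡ true
  before-here {x} {y} (z ∷ l) m y∉ with x ≟ z | y ≟ z
  ... | yes _ | _       = refl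
  ... | no _  | yes y≡z = ⊥-elim (y∉ (here y≡z))
  ... | no x≢z | no _ with m
  ...   | here x≡z = ⊥-elim (x≢z x≡z)
  ...   | there m′ = before-here l m′ (λ m″ → y∉ (there m″))

  before-++ˡ : ∀ {x y} l₁ {l₂} → x ∈ l₁ ⊎ y ∈ l₁ → before s x y (l₁ ++ l₂) ≡ before s x y l₁
  before-++ˡ []       (inj₁ ())
  before-++ˡ []       (inj₂ ())
  before-++ˡ {x} {y} (z ∷ l₁) m with x ≟ z | y ≟ z
  ... | yes _  | _      = refl
  ... | no _   | yes _  = refl
  ... | no x≢z | no y≢z = before-++ˡ l₁ (tail m)
    where
    tail : x ∈ z ∷ l₁ ⊎ y ∈ z ∷ l₁ → x ∈ l₁ ⊎ y ∈ l₁
    tail (inj₁ (here x≡z)) = ⊥-elim (x≢z x≡z)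
    tail (inj₁ (there m′)) = inj₁ m′
    tail (inj₂ (here y≡z)) = ⊥-elim (y≢z y≡z)
    tail (inj₂ (there m′)) = inj₂ m′

  before-++ʳ : ∀ {x y} l₁ {l₂} → x ∉ l₁ → y ∉ l₁ → before s x y (l₁ ++ l₂) ≡ before s x y l₂
  before-++ʳ []                 x∉ y∉ = refl
  before-++ʳ {x} {y} (z ∷ l₁) x∉ y∉ with x ≟ z | y ≟ z
  ... | yes x≡z | _       = ⊥-elim (x∉ (here x≡z))
  ... | no _    | yes y≡z = ⊥-elim (y∉ (here y≡z))
  ... | no _    | no _    = before-++ʳ l₁ (λ m → x∉ (there m)) (λ m → y∉ (there m))

  before-self : ∀ {x} l → x ∈ l → before s x x l ≡ true
  before-self {x} (z ∷ l) m with x ≟ z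
  ... | yes _ = refl
  ... | no x≢z with m
  ...   | here x≡z = ⊥-elim (x≢z x≡z)
  ...   | there m′ = before-self l m′

  before-swap : ∀ {x y} l → x ≢ y → x ∈ l → before s x y l ≡ not (before s y x l)
  before-swap {x} {y} (z ∷ l) x≢y m with x ≟ z | y ≟ z
  ... | yes x≡z | yes y≡z = ⊥-elim (x≢y (trans x≡z (sym y≡z)))
  ... | yes _   | no _    = refl
  ... | no _    | yes _   = refl
  ... | no x≢z  | no _ with m
  ...   | here x≡z = ⊥-elim (x≢z x≡z)
  ...   | there m′ = before-swap l x≢y m′

  before-first-child : ∀ {m} (cs : Vec Tree m) {x y k t} → Child cs k t → (x ∈ labels s t ⊎ y ∈ labels s t) →
    (∀ {k′ t′} → Child cs k′ t′ → (x ∈ labels s t′ ⊎ y ∈ labels s t′) → k ≤ k′) →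
    before s x y (labelsV s cs) ≡ before s x y (labels s t)
  before-first-child (t ∷ ts) here      m first = before-++ˡ (labels s t) m
  before-first-child (t ∷ ts) (there c) m first =
    trans (before-++ʳ (labels s t) (λ m′ → 1+n≰0 (first here (inj₁ m′)))
                                   (λ m′ → 1+n≰0 (first here (inj₂ m′))))
          (before-first-child ts c m (λ c′ m′ → ≤-pred (first (there c′) m′)))
    where
    1+n≰0 : ∀ {k} → suc k ≰ 0
    1+n≰0 ()

  ≺⇒before : ∀ T → Unique (labels s T) → ∀ {q p x y cx cy} →
    Subtree T q (node x cx) → Subtree T p (node y cy) → q ≺ p → before s x y (labels s T) ≡ true
  ≺⇒before (node i cs) u {x = x} root s₂ q≺p with x ≟ x
  ... | yes _   = refl
  ... | no x≢x = ⊥-elim (x≢x refl)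
  ≺⇒before (node i cs) u (child c s₁) root q≺p = ⊥-elim (≺-[] q≺p)
  ≺⇒before (node i cs) u {x = x} {y} {cx} {cy}
    (child {k = kx} {t = tx} cx′ s₁) (child {k = ky} {t = ty} cy′ s₂) q≺p with x ≟ i | y ≟ i
  ... | yes refl | _        = ⊥-elim (root∉children u cx′ (VertexAt⇒∈ (cx , s₁)))
  ... | no _     | yes refl = ⊥-elim (root∉children u cy′ (VertexAt⇒∈ (cy , s₂)))
  ... | no _     | no _     = by-position (≺-∷⁻ q≺p)
    where
    u′ : Unique (labelsV s cs)
    u′ = AllPairs.tail u
    x∈tx : x ∈ labels s tx
    x∈tx = VertexAt⇒∈ (cx , s₁)
    y∈ty : y ∈ labels s ty
    y∈ty = VertexAt⇒∈ (cy , s₂)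
    tx-first : kx ≤ ky → ∀ {k′ t′} → Child cs k′ t′ → (x ∈ labels s t′ ⊎ y ∈ labels s t′) → kx ≤ k′
    tx-first kx≤ky c′ (inj₁ m) = ≤-reflexive (Child-index-unique cs u′ cx′ c′ x∈tx m)
    tx-first kx≤ky c′ (inj₂ m) = ≤-trans kx≤ky (≤-reflexive (Child-index-unique cs u′ cy′ c′ y∈ty m))
    by-position : (kx ≡ ky × _ ≺ _) ⊎ kx <ℕ ky → before s x y (labelsV s cs) ≡ true
    by-position (inj₁ (refl , q≺p′)) with Child-functional cx′ cy′
    ... | refl = trans (before-first-child cs cx′ (inj₁ x∈tx) (tx-first ≤-refl))
                       (≺⇒before tx (Child-Unique cs u′ cx′) s₁ s₂ q≺p′)
    by-position (inj₂ kx<ky) =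
      trans (before-first-child cs cx′ (inj₁ x∈tx) (tx-first (<⇒≤ kx<ky)))
            (before-here (labels s tx) x∈tx
              (λ y∈tx → <-irrefl (Child-index-unique cs u′ cx′ cy′ y∈tx y∈ty) kx<ky))

  module TreeAddressing (T : Tree) (hT : IsSDecreasing s T) where

    labels-unique : Unique (labels s T)
    labels-unique = Permutationₛ.Unique-resp-↭ (setoid (Fin n)) (↭⇒↭ₛ (↭-sym (proj₁ hT))) (allFin⁺ n)

    labelled : ∀ x → x ∈ labels s T
    labelled x = ∈-resp-↭ (↭-sym (proj₁ hT)) (∈-allFin x)

    vertex : ∀ x → Σ Address λ p → VertexAt T p x
    vertex x = ∈⇒VertexAt T (labelled x)

    addr : Fin n → Address
    addr x = proj₁ (vertex x)

    children : ∀ x → Vec Tree (suc (s x))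
    children x = proj₁ (proj₂ (vertex x))

    subtree : ∀ x → Subtree T (addr x) (node x (children x))
    subtree x = proj₂ (proj₂ (vertex x))

    subtree-at : ∀ {x p} → addr x ≡ p → Subtree T p (node x (children x))
    subtree-at refl = subtree _

    addr-unique : ∀ {p x} → VertexAt T p x → p ≡ addr x
    addr-unique v = VertexAt-unique T labels-unique v (proj₂ (vertex _))

    addr-injective : ∀ x y → addr x ≡ addr y → x ≡ y
    addr-injective x y e = node-injectiveˡ (Subtree-functional (subtree-at e) (subtree y))

    below : ∀ {x e k r} → addr x ≡ addr e ++ k ∷ r →
      Σ Tree λ t → Child (children e) k t × Subtree t r (node x (children x))
    below {e = e} eq with Subtree-++⁻ (addr e) (subtree-at eq)
    ... | w , s₁ , child c s₂ with Subtree-functional s₁ (subtree e)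
    ...   | refl = _ , c , s₂

    addr-decreasing : ∀ x e k r → addr x ≡ addr e ++ k ∷ r → x < e
    addr-decreasing x e k r eq with below eq | Subtree-decreasing (subtree e) (proj₂ hT)
    ... | _ , c , s₂ | node below-e _ = All.lookup below-e (Child-labels c (VertexAt⇒∈ (_ , s₂)))

    addr-prefix : ∀ x c k r → addr x ≡ c ++ k ∷ r → Σ (Fin n) λ e → addr e ≡ c
    addr-prefix x c k r eq with Subtree-++⁻ c (subtree-at eq)
    ... | node e ce , s₁ , _ = e , sym (addr-unique (ce , s₁))

    addr-arity : ∀ x e k r → addr x ≡ addr e ++ k ∷ r → k ≤ s e
    addr-arity x e k r eq with below eq
    ... | _ , c , _ = ≤-pred (Child-bound c)

    addressing : Addressing s
    addressing = record
      { addr = addr ; addr-injective = addr-injective ; addr-decreasing = addr-decreasing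
      ; addr-prefix = addr-prefix ; addr-arity = addr-arity }

    subtreeAt-addr : ∀ y → subtreeAt s y T ≡ just (node y (children y))
    subtreeAt-addr y with subtreeAt s y T in eq
    ... | nothing = ⊥-elim (subtreeAt-complete T (labelled y) eq)
    ... | just u with subtreeAt-sound T eq
    ...   | p , s₁ , cs , refl with addr-unique (cs , s₁)
    ...     | refl = cong just (Subtree-functional s₁ (subtree y))

    addr-child : ∀ {y j t x} → Child (children y) j t → x ∈ labels s t → Σ Address λ r → addr x ≡ addr y ++ j ∷ r
    addr-child {y} {t = t} c m with ∈⇒VertexAt t m
    ... | r , cs , s₁ = r , sym (addr-unique (cs , Subtree-++ (subtree y) (child c s₁)))

    InChild⇒addr : ∀ {y j x} → InChild s T y j x → Σ Address λ r → addr x ≡ addr y ++ toℕ j ∷ r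
    InChild⇒addr {y} {j} (cs , eq , m) with trans (sym eq) (subtreeAt-addr y)
    ... | refl = addr-child (Child-lookup cs j) m

    addr⇒InChild : ∀ {y k r x} → addr x ≡ addr y ++ k ∷ r →
      Σ (Fin (suc (s y))) λ j → toℕ j ≡ k × InChild s T y j x
    addr⇒InChild {y} eq with below eq
    ... | t , c , s₂ with Child⇒lookup c
    ...   | j , refl , refl = j , refl , children y , subtreeAt-addr y , VertexAt⇒∈ (_ , s₂)

    before-addr : ∀ {x y} → addr x ≺ addr y → before s x y (labels s T) ≡ true
    before-addr = ≺⇒before T labels-unique (subtree _) (subtree _)

    count-outside : ∀ y x → (∀ {j t} → Child (children y) j t → x ∉ labels s t) →
      (if before s x y (labels s T) then 0 else s y) ≡ addrCount (s y) (addr y) (addr x)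
    count-outside y x x∉children with compare (addr y) (addr x)
    ... | equal e with addr-injective y x e
    ...   | refl rewrite before-self (labels s T) (labelled y) = sym (addrCount-self (s y) (addr y))
    count-outside y x x∉children | extension k r e with below e
    ... | _ , c , s₂ = ⊥-elim (x∉children c (VertexAt⇒∈ (_ , s₂)))
    count-outside y x x∉children | prefix k r e rewrite before-addr (ancestor k r e) =
      sym (trans (cong (λ p → addrCount (s y) p (addr x)) e) (addrCount-prefix (s y) (addr x) k r))
    count-outside y x x∉children | left x◁y rewrite before-addr (leftOf x◁y) = sym (addrCount-◁ (s y) x◁y)
    count-outside y x x∉children | right y◁x
      rewrite trans (before-swap (labels s T) (λ { refl → ◁-irrefl y◁x }) (labelled x))
                    (cong not (before-addr (leftOf y◁x))) =
        sym (addrCount-▷ (s y) y◁x)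

    count≡addrCount : ∀ y x → count s T y x ≡ addrCount (s y) (addr y) (addr x)
    count≡addrCount y x rewrite subtreeAt-addr y with childIndex s x (children y) 0 in eq
    ... | nothing = count-outside y x (childIndex-nothing (children y) 0 eq)
    ... | just k with childIndex-just (children y) 0 eq
    ...   | j , t , refl , c , m with addr-child c m
    ...     | r , ex = sym (trans (cong (addrCount (s y) (addr y)) ex) (addrCount-extension (s y) (addr y) j r))

    treeAscent⇒Ascent : ∀ {a b} → TreeAscent s T a b → Ascent addressing a b
    treeAscent⇒Ascent ((i , i<s , a∈) , rightmost , _) = record
      { index = toℕ i
      ; rest = proj₁ (InChild⇒addr a∈)
      ; addr-a = proj₂ (InChild⇒addr a∈)
      ; index<arity = i<s
      ; rightmost = λ e a<e e<b k r eq → case-child (addr⇒InChild eq) (rightmost e a<e e<b) }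
      where
      case-child : ∀ {e k x} → Σ (Fin (suc (s e))) (λ j → toℕ j ≡ k × InChild s T e j x) →
        (∀ j → InChild s T e j x → toℕ j ≡ s e) → k ≡ s e
      case-child (j , refl , j∈) rightmost-j = rightmost-j j j∈

    InMinus0⇔inMinus0ᵇ : ∀ {a e} → InMinus0 s T a e ⇔ (inMinus0ᵇ (addr a) (addr e) ≡ true)
    InMinus0⇔inMinus0ᵇ {a} {e} = mk⇔ to from
      where
      to : InMinus0 s T a e → inMinus0ᵇ (addr a) (addr e) ≡ true
      to (inj₁ refl) = inMinus0ᵇ-self (addr a)
      to (inj₂ (j , 0<j , e∈)) with InChild⇒addr e∈
      ... | r , eq rewrite eq = inMinus0ᵇ-child (addr a) r 0<j
      from : inMinus0ᵇ (addr a) (addr e) ≡ true → InMinus0 s T a e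
      from h with inMinus0ᵇ-sound (addr a) (addr e) h
      ... | self eq = inj₁ (addr-injective e a eq)
      ... | child k r 0<k eq with addr⇒InChild eq
      ...   | j , refl , e∈ = inj₂ (j , 0<k , e∈)

proposition3p8 : ∀ {n : ℕ} (s : Fin n → ℕ) (T Z : STree s) →
    IsSDecreasing s T → IsSDecreasing s Z →
    (a b : Fin n) → a < b → TreeAscent s T a b →
    IsTC s (addPair s (inv s T) b a) (inv s Z) →
    ∀ (e f : Fin n) → e < f →
      ((count s T f e <ℕ count s Z f e) ⇔ ((f ≡ b) × InMinus0 s T a e))
      × ((f ≡ b) × InMinus0 s T a e → count s Z f e ≡ suc (count s T f e))
-- Z enters only through inv(Z), and a < b follows from the ascent.
proposition3p8 s T Z hT _ a b _ ascent tc e f e<f =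
  ⇔-sym (⇔-id _ ×-⇔ InMinus0⇔inMinus0ᵇ) ⇔-∘ I<J⇔ asc (inv s Z) tc e f e<f ,
  λ (f≡b , e∈) → J-increment asc (inv s Z) tc e f e<f (f≡b , Equivalence.to InMinus0⇔inMinus0ᵇ e∈)
  where
  open Trees s
  open TreeAddressing T hT
  open Rotation addressing (inv s T) count≡addrCount
  asc : Ascent addressing a b
  asc = treeAscent⇒Ascent ascent
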